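{- Let $R$ be a commutative ring with identity, let $A,B\in R$, and let $(w_n)_{n\ge0}$ be a sequence of elements of $R$ satisfying $w_{n+1}=Aw_n-Bw_{n-1}$ for all $n=1,2,3,\ldots$. Put $$A'=(A^2-B^2+1)w_0-2Aw_1\quad\text{and}\quad B'=\big(Aw_0-(B+1)w_1\big)^2.$$ Then for every positive integer $n$, $$\det[w_{|j-k|}]_{1\le j,k\le n}=w_0\,u_n(A',B')+\big((Bw_0)^2-(Aw_0-w_1)^2\big)\,u_{n-1}(A',B').$$
   Context: For elements $x,y$ of a commutative ring with identity, the Lucas sequence $(u_n(x,y))_{n\ge0}$ is defined by $u_0(x,y)=0$, $u_1(x,y)=1$, and $u_{n+1}(x,y)=xu_n(x,y)-yu_{n-1}(x,y)$ for $n\ge1$. -}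

module Defs where

open import Level using (Level)
open import Algebra.Bundles using (CommutativeRing)
open import Data.Nat using (ℕ; zero; suc)
open import Data.Fin using (Fin; zero; suc; punchIn)

module _ {c ℓ : Level} (R : CommutativeRing c ℓ) where
  open CommutativeRing R hiding (zero)

  lucas : Carrier → Carrier → ℕ → Carrier
  lucas x y zero = 0#
  lucas x y (suc zero) = 1#
  lucas x y (suc (suc n)) = x * lucas x y (suc n) - y * lucas x y n

  sumFin : (n : ℕ) → (Fin n → Carrier) → Carrier
  sumFin zero f = 0#
  sumFin (suc n) f = f zero + sumFin n (λ i → f (suc i))

  sgn : ℕ → Carrier
  sgn zero = 1#
  sgn (suc k) = - sgn k

  minor : {n : ℕ} → (Fin (suc n) → Fin (suc n) → Carrier) → Fin (suc n) → Fin n → Fin n → Carrier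
  minor M k i j = M (suc i) (punchIn k j)

  det : (n : ℕ) → (Fin n → Fin n → Carrier) → Carrier
  det zero M = 1#
  det (suc n) M = sumFin (suc n) (λ k → sgn (Data.Fin.toℕ k) * (M zero k * det n (minor M k)))

{-# OPTIONS --safe #-}
module Submission where

open import Level using (Level)
open import Algebra.Bundles using (CommutativeRing)
open import Data.Nat as ℕ using (ℕ; zero; suc; _<_; _≤_; _<?_; _≤?_; s≤s; z≤n; _∸_; ∣_-_∣)
import Data.Nat.Properties as ℕ
open import Data.Integer as ℤ using (ℤ; +_; -[1+_]; _⊖_)
import Data.Integer.Properties as ℤ
open import Data.Fin as Fin using (Fin; zero; suc; toℕ; punchIn; punchOut; inject₁; fromℕ<)
open import Data.Fin.Properties
  using (suc-injective; punchIn-punchOut; punchIn-injective; punchInᵢ≢i; toℕ-inject₁; toℕ-fromℕ<; toℕ-injective; toℕ<n; <-cmp)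
open import Data.Fin.Permutation.Components using (transpose)
open import Data.Maybe using (Maybe; nothing; just)
open import Data.Product using (_×_; _,_)
open import Data.Sum using (_⊎_; inj₁; inj₂)
open import Function using (_∘_; flip)
open import Relation.Binary.PropositionalEquality as ≡ using (_≡_; _≢_)
open import Relation.Binary.Definitions using (tri<; tri≈; tri>)
open import Relation.Nullary using (yes; no; contradiction)
open import Relation.Nullary.Decidable using (dec-true; dec-false)
import Algebra.Solver.Ring.AlmostCommutativeRing as ACR
import Algebra.Properties.Monoid.Mult.TCOptimised as MonoidMult
import Algebra.Properties.Semiring.Mult.TCOptimised as SemiringMult
open import Defs

-- Let U be the upper unitriangular matrix of the column operations C_k ← C_k − A C_{k−1} + B C_{k−2}
-- (k ≥ 2). Because w satisfies the recurrence, Uᵀ T U with T = (w_{|j−k|}) is tridiagonal, with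
-- diagonal (w₀, w₀, A′, A′, …) and off-diagonal (w₁, −t, −t, …) where t = A w₀ − (B + 1) w₁.
-- As det U = 1, det T is this tridiagonal determinant. Expanding it by the continuant recurrence,
-- the block from the third row on gives u(A′, t²), and the top corner contributes
-- w₀² − w₁² = w₀ A′ + (B w₀)² − (A w₀ − w₁)².

data Adjacent : ∀ {n} → Fin n → Fin n → Set where
  zero : ∀ {n} → Adjacent {suc (suc n)} zero (suc zero)
  suc  : ∀ {n} {p q : Fin n} → Adjacent p q → Adjacent (suc p) (suc q)

Adjacent⇒toℕ : ∀ {n} {p q : Fin n} → Adjacent p q → toℕ q ≡ suc (toℕ p)
Adjacent⇒toℕ zero = ≡.refl
Adjacent⇒toℕ (suc adj) = ≡.cong suc (Adjacent⇒toℕ adj)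

toℕ⇒Adjacent : ∀ {n} {p q : Fin n} → toℕ q ≡ suc (toℕ p) → Adjacent p q
toℕ⇒Adjacent {p = zero} {q = suc zero} ≡.refl = zero
toℕ⇒Adjacent {p = suc p} {q = suc q} e = suc (toℕ⇒Adjacent (ℕ.suc-injective e))

inject₁-Adjacent : ∀ {n} (i : Fin n) → Adjacent (inject₁ i) (suc i)
inject₁-Adjacent zero = zero
inject₁-Adjacent (suc i) = suc (inject₁-Adjacent i)

punchOut-Adjacent : ∀ {n} {k p q : Fin (suc n)} (k≢p : k ≢ p) (k≢q : k ≢ q) →
                    Adjacent p q → Adjacent (punchOut k≢p) (punchOut k≢q)
punchOut-Adjacent {k = zero} k≢p k≢q zero = contradiction ≡.refl k≢p
punchOut-Adjacent {k = suc zero} k≢p k≢q zero = contradiction ≡.refl k≢q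
punchOut-Adjacent {suc (suc n)} {k = suc (suc k)} k≢p k≢q zero = zero
punchOut-Adjacent {k = zero} k≢p k≢q (suc adj) = adj
punchOut-Adjacent {suc n} {k = suc k} k≢p k≢q (suc adj) =
  suc (punchOut-Adjacent (k≢p ∘ ≡.cong suc) (k≢q ∘ ≡.cong suc) adj)

punchIn-Adjacent : ∀ {n} {p q : Fin (suc n)} → Adjacent p q → ∀ j →
                   (punchIn p j ≡ q × punchIn q j ≡ p) ⊎ punchIn p j ≡ punchIn q j
punchIn-Adjacent zero zero = inj₁ (≡.refl , ≡.refl)
punchIn-Adjacent zero (suc j) = inj₂ ≡.refl
punchIn-Adjacent (suc adj) zero = inj₂ ≡.refl
punchIn-Adjacent (suc adj) (suc j) with punchIn-Adjacent adj j
... | inj₁ (e₁ , e₂) = inj₁ (≡.cong suc e₁ , ≡.cong suc e₂)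
... | inj₂ e = inj₂ (≡.cong suc e)

punchIn≢ : ∀ {n} {k q : Fin (suc n)} {j} (k≢q : k ≢ q) → j ≢ punchOut k≢q → punchIn k j ≢ q
punchIn≢ {k = k} {j = j} k≢q j≢q′ e = j≢q′ (punchIn-injective k j _ (≡.trans e (≡.sym (punchIn-punchOut k≢q))))

fromℕ<-≢ : ∀ {m k n} (m<n : m < n) (k<n : k < n) → m ≢ k → fromℕ< m<n ≢ fromℕ< k<n
fromℕ<-≢ m<n k<n m≢k e = m≢k (≡.trans (≡.sym (toℕ-fromℕ< m<n)) (≡.trans (≡.cong toℕ e) (toℕ-fromℕ< k<n)))

transpose-matchˡ : ∀ {n} (i j : Fin n) → transpose i j i ≡ j
transpose-matchˡ i j rewrite dec-true (i Fin.≟ i) ≡.refl = ≡.refl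

transpose-matchʳ : ∀ {n} (i j : Fin n) → transpose i j j ≡ i
transpose-matchʳ i j with j Fin.≟ i
... | yes j≡i = j≡i
... | no _ rewrite dec-true (j Fin.≟ j) ≡.refl = ≡.refl

transpose-other : ∀ {n} {i j k : Fin n} → k ≢ i → k ≢ j → transpose i j k ≡ k
transpose-other {i = i} {j} {k} k≢i k≢j rewrite dec-false (k Fin.≟ i) k≢i | dec-false (k Fin.≟ j) k≢j = ≡.refl

module IntegerCoefficientSolver {c ℓ : Level} (R : CommutativeRing c ℓ) where
  open CommutativeRing R
  open import Algebra.Properties.Ring ring
  open MonoidMult +-monoid using (×-homo-+; 1+×) renaming (_×_ to _×′_)
  open SemiringMult semiring using (×1-homo-*)
  open import Algebra.Properties.CommutativeSemigroup +-commutativeSemigroup using (x∙yz≈y∙xz)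
  open import Relation.Binary.Reasoning.Setoid setoid

  -- With the TC-optimised multiples, con (+ 0) and con (+ 1) denote 0# and 1# definitionally,
  -- so equations handed to the solver may mention 0# and 1# directly.
  fromℤ : ℤ → Carrier
  fromℤ (+ n) = n ×′ 1#
  fromℤ -[1+ n ] = - (suc n ×′ 1#)

  fromℤ-neg : ∀ i → fromℤ (ℤ.- i) ≈ - fromℤ i
  fromℤ-neg (+ zero) = sym -0#≈0#
  fromℤ-neg (+ suc n) = refl
  fromℤ-neg -[1+ n ] = sym (-‿involutive _)

  fromℤ-⊖ : ∀ m n → fromℤ (m ⊖ n) ≈ m ×′ 1# - n ×′ 1#
  fromℤ-⊖ m zero = begin
    fromℤ (m ⊖ 0)  ≡⟨ ≡.cong fromℤ (ℤ.⊖-≥ {m} z≤n) ⟩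
    m ×′ 1#        ≈⟨ +-identityʳ _ ⟨
    m ×′ 1# + 0#   ≈⟨ +-congˡ -0#≈0# ⟨
    m ×′ 1# - 0#   ∎
  fromℤ-⊖ zero (suc n) = begin
    fromℤ (0 ⊖ suc n)  ≡⟨ ≡.cong fromℤ (ℤ.⊖-< {0} {suc n} (s≤s z≤n)) ⟩
    - (suc n ×′ 1#)    ≈⟨ +-identityˡ _ ⟨
    0# - suc n ×′ 1#   ∎
  fromℤ-⊖ (suc m) (suc n) = begin
    fromℤ (suc m ⊖ suc n)            ≡⟨ ≡.cong fromℤ (ℤ.[1+m]⊖[1+n]≡m⊖n m n) ⟩
    fromℤ (m ⊖ n)                    ≈⟨ fromℤ-⊖ m n ⟩
    m ×′ 1# - n ×′ 1#                ≈⟨ +-cancelˡ-‿ 1# _ _ ⟨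
    (1# + m ×′ 1#) - (1# + n ×′ 1#)  ≈⟨ +-cong (1+× m 1#) (-‿cong (1+× n 1#)) ⟨
    suc m ×′ 1# - suc n ×′ 1#        ∎
    where
    +-cancelˡ-‿ : ∀ a x y → (a + x) - (a + y) ≈ x - y
    +-cancelˡ-‿ a x y = begin
      (a + x) - (a + y)        ≈⟨ +-congˡ (-‿+-comm a y) ⟨
      (a + x) + (- a + - y)    ≈⟨ +-assoc a x _ ⟩
      a + (x + (- a + - y))    ≈⟨ +-congˡ (x∙yz≈y∙xz x (- a) (- y)) ⟩
      a + (- a + (x - y))      ≈⟨ +-assoc a (- a) _ ⟨
      (a - a) + (x - y)        ≈⟨ +-congʳ (-‿inverseʳ a) ⟩
      0# + (x - y)             ≈⟨ +-identityˡ _ ⟩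
      x - y                    ∎

  fromℤ-+ : ∀ i j → fromℤ (i ℤ.+ j) ≈ fromℤ i + fromℤ j
  fromℤ-+ (+ m) (+ n) = ×-homo-+ 1# m n
  fromℤ-+ (+ m) -[1+ n ] = fromℤ-⊖ m (suc n)
  fromℤ-+ -[1+ m ] (+ n) = trans (fromℤ-⊖ n (suc m)) (+-comm _ _)
  fromℤ-+ -[1+ m ] -[1+ n ] = begin
    fromℤ (-[1+ m ] ℤ.+ -[1+ n ])      ≡⟨ ≡.cong fromℤ (ℤ.neg-distrib-+ (+ suc m) (+ suc n)) ⟨
    fromℤ (ℤ.- (+ suc m ℤ.+ + suc n))  ≈⟨ fromℤ-neg (+ suc m ℤ.+ + suc n) ⟩
    - fromℤ (+ suc m ℤ.+ + suc n)      ≈⟨ -‿cong (×-homo-+ 1# (suc m) (suc n)) ⟩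
    - (suc m ×′ 1# + suc n ×′ 1#)      ≈⟨ -‿+-comm _ _ ⟨
    fromℤ -[1+ m ] + fromℤ -[1+ n ]    ∎

  fromℤ-*-pos : ∀ i n → fromℤ (i ℤ.* + n) ≈ fromℤ i * fromℤ (+ n)
  fromℤ-*-pos (+ m) n = begin
    fromℤ (+ m ℤ.* + n)        ≡⟨ ≡.cong fromℤ (ℤ.pos-* m n) ⟨
    (m ℕ.* n) ×′ 1#            ≈⟨ ×1-homo-* m n ⟩
    fromℤ (+ m) * fromℤ (+ n)  ∎
  fromℤ-*-pos -[1+ m ] n = begin
    fromℤ (ℤ.- + suc m ℤ.* + n)        ≡⟨ ≡.cong fromℤ (ℤ.neg-distribˡ-* (+ suc m) (+ n)) ⟨
    fromℤ (ℤ.- (+ suc m ℤ.* + n))      ≈⟨ fromℤ-neg (+ suc m ℤ.* + n) ⟩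
    - fromℤ (+ suc m ℤ.* + n)          ≈⟨ -‿cong (fromℤ-*-pos (+ suc m) n) ⟩
    - (fromℤ (+ suc m) * fromℤ (+ n))  ≈⟨ -‿distribˡ-* _ _ ⟩
    fromℤ -[1+ m ] * fromℤ (+ n)       ∎

  fromℤ-* : ∀ i j → fromℤ (i ℤ.* j) ≈ fromℤ i * fromℤ j
  fromℤ-* i (+ n) = fromℤ-*-pos i n
  fromℤ-* i -[1+ n ] = begin
    fromℤ (i ℤ.* ℤ.- + suc n)        ≡⟨ ≡.cong fromℤ (ℤ.neg-distribʳ-* i (+ suc n)) ⟨
    fromℤ (ℤ.- (i ℤ.* + suc n))      ≈⟨ fromℤ-neg (i ℤ.* + suc n) ⟩
    - fromℤ (i ℤ.* + suc n)          ≈⟨ -‿cong (fromℤ-*-pos i (suc n)) ⟩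
    - (fromℤ i * fromℤ (+ suc n))    ≈⟨ -‿distribʳ-* _ _ ⟩
    fromℤ i * fromℤ -[1+ n ]         ∎

  ℤ-morphism : CommutativeRing.rawRing ℤ.+-*-commutativeRing ACR.-Raw-AlmostCommutative⟶ ACR.fromCommutativeRing R
  ℤ-morphism = record
    { ⟦_⟧    = fromℤ
    ; +-homo = fromℤ-+
    ; *-homo = fromℤ-*
    ; -‿homo = fromℤ-neg
    ; 0-homo = refl
    ; 1-homo = refl
    }

  fromℤ-≟ : ∀ i j → Maybe (fromℤ i ≈ fromℤ j)
  fromℤ-≟ i j with i ℤ.≟ j
  ... | yes ≡.refl = just refl
  ... | no _ = nothing

  open import Algebra.Solver.Ring _ _ ℤ-morphism fromℤ-≟ public

module _ {c ℓ : Level} (R : CommutativeRing c ℓ) where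
  open CommutativeRing R hiding (zero)
  open import Algebra.Properties.Ring ring
  open import Algebra.Properties.CommutativeSemigroup +-commutativeSemigroup using (interchange)
  open IntegerCoefficientSolver R using (solve; _:=_; _:+_; _:*_; _:-_; :-_; con)
  open import Relation.Binary.Reasoning.Setoid setoid

  Matrix : ℕ → Set c
  Matrix n = Fin n → Fin n → Carrier

  mat : ∀ {n} → (ℕ → ℕ → Carrier) → Matrix n
  mat F i j = F (toℕ i) (toℕ j)

  _ᵀ : ∀ {n} → Matrix n → Matrix n
  (M ᵀ) i j = M j i

  AgreeOffColumn : ∀ {n} → Fin n → Matrix n → Matrix n → Set ℓ
  AgreeOffColumn q M N = ∀ i j → j ≢ q → M i j ≈ N i j

  ∑ : (n : ℕ) → (Fin n → Carrier) → Carrier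
  ∑ = sumFin R

  ∑-cong : ∀ n {f g : Fin n → Carrier} → (∀ i → f i ≈ g i) → ∑ n f ≈ ∑ n g
  ∑-cong zero f≈g = refl
  ∑-cong (suc n) f≈g = +-cong (f≈g zero) (∑-cong n (f≈g ∘ suc))

  ∑-zero : ∀ n {f : Fin n → Carrier} → (∀ i → f i ≈ 0#) → ∑ n f ≈ 0#
  ∑-zero zero f≈0 = refl
  ∑-zero (suc n) f≈0 = trans (+-cong (f≈0 zero) (∑-zero n (f≈0 ∘ suc))) (+-identityˡ 0#)

  ∑-+ : ∀ n (f g : Fin n → Carrier) → ∑ n (λ i → f i + g i) ≈ ∑ n f + ∑ n g
  ∑-+ zero f g = sym (+-identityˡ 0#)
  ∑-+ (suc n) f g = trans (+-congˡ (∑-+ n (f ∘ suc) (g ∘ suc))) (interchange _ _ _ _)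

  *-distribˡ-∑ : ∀ n x (f : Fin n → Carrier) → x * ∑ n f ≈ ∑ n (λ i → x * f i)
  *-distribˡ-∑ zero x f = zeroʳ x
  *-distribˡ-∑ (suc n) x f = trans (distribˡ x _ _) (+-congˡ (*-distribˡ-∑ n x (f ∘ suc)))

  ∑-neg : ∀ n (f : Fin n → Carrier) → ∑ n (λ i → - f i) ≈ - ∑ n f
  ∑-neg zero f = sym -0#≈0#
  ∑-neg (suc n) f = trans (+-congˡ (∑-neg n (f ∘ suc))) (-‿+-comm _ _)

  ∑-comm : ∀ m n (F : Fin m → Fin n → Carrier) →
           ∑ m (λ i → ∑ n (F i)) ≈ ∑ n (λ j → ∑ m (λ i → F i j))
  ∑-comm zero n F = sym (∑-zero n (λ _ → refl))
  ∑-comm (suc m) n F = trans (+-congˡ (∑-comm m n (F ∘ suc))) (sym (∑-+ n (F zero) _))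

  laplaceTerm : ∀ {n} → Matrix (suc n) → Fin (suc n) → Carrier
  laplaceTerm {n} M k = sgn R (toℕ k) * (M zero k * det R n (minor R M k))

  det-cong : ∀ n {M N : Matrix n} → (∀ i j → M i j ≈ N i j) → det R n M ≈ det R n N
  det-cong zero M≈N = refl
  det-cong (suc n) {M} {N} M≈N = ∑-cong (suc n) term≈
    where
    term≈ : ∀ k → laplaceTerm M k ≈ laplaceTerm N k
    term≈ k = *-congˡ (*-cong (M≈N zero k) (det-cong n λ i j → M≈N (suc i) (punchIn k j)))

  -- minor R (M ᵀ) i ᵀ is M with row i and column 0 deleted.
  det-expandFirstColumn : ∀ n (M : Matrix (suc n)) →
    det R (suc n) M ≈ ∑ (suc n) (λ i → sgn R (toℕ i) * (M i zero * det R n (minor R (M ᵀ) i ᵀ)))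
  det-expandFirstColumn zero M = refl
  det-expandFirstColumn (suc n) M = +-congˡ (begin
      ∑ (suc n) (λ k → - σ k * (M zero (suc k) * det R (suc n) (minor R M (suc k))))
        ≈⟨ ∑-cong (suc n) expandRow ⟩
      ∑ (suc n) (λ k → ∑ (suc n) (λ i → term i k))
        ≈⟨ ∑-comm (suc n) (suc n) (λ k i → term i k) ⟩
      ∑ (suc n) (λ i → ∑ (suc n) (term i))
        ≈⟨ ∑-cong (suc n) collectColumn ⟩
      ∑ (suc n) (λ i → - σ i * (M (suc i) zero * det R (suc n) (minor R (M ᵀ) (suc i) ᵀ))) ∎)
    where
    σ : Fin (suc n) → Carrier
    σ k = sgn R (toℕ k)
    X : Fin (suc n) → Fin (suc n) → Carrier
    X i k = det R n (λ a b → M (suc (punchIn i a)) (suc (punchIn k b)))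
    term : Fin (suc n) → Fin (suc n) → Carrier
    term i k = - σ i * (M (suc i) zero * (σ k * (M zero (suc k) * X i k)))
    pull : ∀ s a (f : Fin (suc n) → Carrier) → s * (a * ∑ (suc n) f) ≈ ∑ (suc n) (λ i → s * (a * f i))
    pull s a f = trans (*-congˡ (*-distribˡ-∑ (suc n) a f)) (*-distribˡ-∑ (suc n) s (λ i → a * f i))
    reorder : ∀ s a t b x → - s * (a * (t * (b * x))) ≈ - t * (b * (s * (a * x)))
    reorder = solve 5 (λ s a t b x → :- s :* (a :* (t :* (b :* x))) := :- t :* (b :* (s :* (a :* x)))) refl
    expandRow : ∀ k → - σ k * (M zero (suc k) * det R (suc n) (minor R M (suc k))) ≈ ∑ (suc n) (λ i → term i k)
    expandRow k = begin
      - σ k * (M zero (suc k) * det R (suc n) (minor R M (suc k)))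
        ≈⟨ *-congˡ (*-congˡ (det-expandFirstColumn n (minor R M (suc k)))) ⟩
      - σ k * (M zero (suc k) * ∑ (suc n) (λ i → σ i * (M (suc i) zero * X i k)))
        ≈⟨ pull (- σ k) (M zero (suc k)) (λ i → σ i * (M (suc i) zero * X i k)) ⟩
      ∑ (suc n) (λ i → - σ k * (M zero (suc k) * (σ i * (M (suc i) zero * X i k))))
        ≈⟨ ∑-cong (suc n) (λ i → reorder (σ k) (M zero (suc k)) (σ i) (M (suc i) zero) (X i k)) ⟩
      ∑ (suc n) (λ i → term i k) ∎
    collectColumn : ∀ i → ∑ (suc n) (term i) ≈ - σ i * (M (suc i) zero * ∑ (suc n) (λ k → σ k * (M zero (suc k) * X i k)))
    collectColumn i = sym (pull (- σ i) (M (suc i) zero) (λ k → σ k * (M zero (suc k) * X i k)))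

  det-transpose : ∀ n (M : Matrix n) → det R n (M ᵀ) ≈ det R n M
  det-transpose zero M = refl
  det-transpose (suc n) M = begin
    det R (suc n) (M ᵀ)                                                          ≈⟨ ∑-cong (suc n) term≈ ⟩
    ∑ (suc n) (λ k → sgn R (toℕ k) * (M k zero * det R n (minor R (M ᵀ) k ᵀ)))  ≈⟨ det-expandFirstColumn n M ⟨
    det R (suc n) M                                                              ∎
    where
    term≈ : ∀ k → sgn R (toℕ k) * (M k zero * det R n (minor R (M ᵀ) k)) ≈ sgn R (toℕ k) * (M k zero * det R n (minor R (M ᵀ) k ᵀ))
    term≈ k = *-congˡ (*-congˡ (sym (det-transpose n (minor R (M ᵀ) k))))

  minor-agreeOnColumn : ∀ {n} {M N : Matrix (suc n)} q → AgreeOffColumn q M N →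
                        ∀ i j → minor R M q i j ≈ minor R N q i j
  minor-agreeOnColumn q M≈N i j = M≈N (suc i) (punchIn q j) (punchInᵢ≢i q j)

  minor-agreeOffColumn : ∀ {n} {M N : Matrix (suc n)} {k q} (k≢q : k ≢ q) → AgreeOffColumn q M N →
                         AgreeOffColumn (punchOut k≢q) (minor R M k) (minor R N k)
  minor-agreeOffColumn {k = k} k≢q M≈N i j j≢q′ = M≈N (suc i) (punchIn k j) (punchIn≢ k≢q j≢q′)

  atPunchOut : ∀ {n} {k q : Fin (suc n)} (k≢q : k ≢ q) (P : Fin (suc n) → Set ℓ) → P q → P (punchIn k (punchOut k≢q))
  atPunchOut k≢q P = ≡.subst P (≡.sym (punchIn-punchOut k≢q))

  det-linearInColumn : ∀ n (q : Fin n) {M N Q : Matrix n} x →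
    AgreeOffColumn q M N → AgreeOffColumn q Q N → (∀ i → M i q ≈ N i q + x * Q i q) →
    det R n M ≈ det R n N + x * det R n Q
  det-linearInColumn zero ()
  det-linearInColumn (suc n) q {M} {N} {Q} x M≈N Q≈N Mq≈ = begin
    det R (suc n) M                                          ≈⟨ ∑-cong (suc n) term≈ ⟩
    ∑ (suc n) (λ k → laplaceTerm N k + x * laplaceTerm Q k)  ≈⟨ ∑-+ (suc n) (laplaceTerm N) (λ k → x * laplaceTerm Q k) ⟩
    det R (suc n) N + ∑ (suc n) (λ k → x * laplaceTerm Q k)  ≈⟨ +-congˡ (*-distribˡ-∑ (suc n) x (laplaceTerm Q)) ⟨
    det R (suc n) N + x * det R (suc n) Q                    ∎
    where
    distribˡ-scaled : ∀ s a b d y → s * ((a + y * b) * d) ≈ s * (a * d) + y * (s * (b * d))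
    distribˡ-scaled = solve 5 (λ s a b d y → s :* ((a :+ y :* b) :* d) := s :* (a :* d) :+ y :* (s :* (b :* d))) refl
    distribʳ-scaled : ∀ s a d e y → s * (a * (d + y * e)) ≈ s * (a * d) + y * (s * (a * e))
    distribʳ-scaled = solve 5 (λ s a d e y → s :* (a :* (d :+ y :* e)) := s :* (a :* d) :+ y :* (s :* (a :* e))) refl
    term≈ : ∀ k → laplaceTerm M k ≈ laplaceTerm N k + x * laplaceTerm Q k
    term≈ k with k Fin.≟ q
    ... | yes ≡.refl = begin
      laplaceTerm M k
        ≈⟨ *-congˡ (*-cong (Mq≈ zero) (det-cong n (minor-agreeOnColumn k M≈N))) ⟩
      σ * ((N zero k + x * Q zero k) * det R n (minor R N k))
        ≈⟨ distribˡ-scaled σ (N zero k) (Q zero k) _ x ⟩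
      laplaceTerm N k + x * (σ * (Q zero k * det R n (minor R N k)))
        ≈⟨ +-congˡ (*-congˡ (*-congˡ (*-congˡ (det-cong n (minor-agreeOnColumn k Q≈N))))) ⟨
      laplaceTerm N k + x * laplaceTerm Q k ∎
      where σ = sgn R (toℕ k)
    ... | no k≢q = begin
      laplaceTerm M k
        ≈⟨ *-congˡ (*-cong (M≈N zero k k≢q) minor-linear) ⟩
      σ * (N zero k * (det R n (minor R N k) + x * det R n (minor R Q k)))
        ≈⟨ distribʳ-scaled σ (N zero k) _ _ x ⟩
      laplaceTerm N k + x * (σ * (N zero k * det R n (minor R Q k)))
        ≈⟨ +-congˡ (*-congˡ (*-congˡ (*-congʳ (Q≈N zero k k≢q)))) ⟨
      laplaceTerm N k + x * laplaceTerm Q k ∎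
      where
      σ = sgn R (toℕ k)
      minor-linear : det R n (minor R M k) ≈ det R n (minor R N k) + x * det R n (minor R Q k)
      minor-linear = det-linearInColumn n (punchOut k≢q) x
        (minor-agreeOffColumn k≢q M≈N) (minor-agreeOffColumn k≢q Q≈N)
        (λ i → atPunchOut k≢q (λ j → M (suc i) j ≈ N (suc i) j + x * Q (suc i) j) (Mq≈ (suc i)))

  ∑-adjacent : ∀ {n} {p q : Fin n} (f g : Fin n → Carrier) → Adjacent p q →
               (∀ k → k ≢ p → k ≢ q → f k ≈ g k) → f p + f q ≈ g p + g q → ∑ n f ≈ ∑ n g
  ∑-adjacent {suc (suc n)} f g zero f≈g pair = begin
    f zero + (f (suc zero) + ∑ n (f ∘ Fin.suc ∘ Fin.suc))   ≈⟨ +-assoc _ _ _ ⟨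
    (f zero + f (suc zero)) + ∑ n (f ∘ Fin.suc ∘ Fin.suc)   ≈⟨ +-cong pair (∑-cong n (λ k → f≈g (suc (suc k)) (λ ()) (λ ()))) ⟩
    (g zero + g (suc zero)) + ∑ n (g ∘ Fin.suc ∘ Fin.suc)   ≈⟨ +-assoc _ _ _ ⟩
    g zero + (g (suc zero) + ∑ n (g ∘ Fin.suc ∘ Fin.suc))   ∎
  ∑-adjacent {suc n} f g (suc adj) f≈g pair =
    +-cong (f≈g zero (λ ()) (λ ()))
           (∑-adjacent (f ∘ Fin.suc) (g ∘ Fin.suc) adj
              (λ k k≢p k≢q → f≈g (suc k) (k≢p ∘ suc-injective) (k≢q ∘ suc-injective)) pair)

  minor-punchOutColumns : ∀ {n} {L L′ : Matrix (suc n)} {k p q} (k≢p : k ≢ p) (k≢q : k ≢ q) → (∀ i → L i p ≈ L′ i q) →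
                          ∀ i → minor R L k i (punchOut k≢p) ≈ minor R L′ k i (punchOut k≢q)
  minor-punchOutColumns k≢p k≢q Lp≈L′q i rewrite punchIn-punchOut k≢p | punchIn-punchOut k≢q = Lp≈L′q (suc i)

  sgn-Adjacent : ∀ {n} {p q : Fin n} → Adjacent p q → sgn R (toℕ q) ≈ - sgn R (toℕ p)
  sgn-Adjacent adj = reflexive (≡.cong (sgn R) (Adjacent⇒toℕ adj))

  det-adjacentEqualColumns : ∀ n {M : Matrix n} {p q} → Adjacent p q → (∀ i → M i p ≈ M i q) → det R n M ≈ 0#
  det-adjacentEqualColumns (suc n) {M} {p} {q} adj Mp≈Mq = begin
    det R (suc n) M       ≈⟨ ∑-adjacent (laplaceTerm M) (λ _ → 0#) adj off pair ⟩
    ∑ (suc n) (λ _ → 0#)  ≈⟨ ∑-zero (suc n) (λ _ → refl) ⟩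
    0#                    ∎
    where
    off : ∀ k → k ≢ p → k ≢ q → laplaceTerm M k ≈ 0#
    off k k≢p k≢q = trans (*-congˡ (*-congˡ minor≈0)) (trans (*-congˡ (zeroʳ _)) (zeroʳ _))
      where
      minor≈0 : det R n (minor R M k) ≈ 0#
      minor≈0 = det-adjacentEqualColumns n (punchOut-Adjacent k≢p k≢q adj) (minor-punchOutColumns {L = M} {L′ = M} k≢p k≢q Mp≈Mq)
    minors≈ : ∀ i j → minor R M p i j ≈ minor R M q i j
    minors≈ i j with punchIn-Adjacent adj j
    ... | inj₁ (pj≡q , qj≡p) rewrite pj≡q | qj≡p = sym (Mp≈Mq (suc i))
    ... | inj₂ pj≡qj rewrite pj≡qj = refl
    cancel : ∀ s y → s * y + - s * y ≈ 0# + 0#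
    cancel s y = trans (+-congˡ (sym (-‿distribˡ-* s y))) (trans (-‿inverseʳ _) (sym (+-identityˡ 0#)))
    pair : laplaceTerm M p + laplaceTerm M q ≈ 0# + 0#
    pair = trans (+-congˡ (*-cong (sgn-Adjacent adj) (*-cong (sym (Mp≈Mq zero)) (sym (det-cong n minors≈))))) (cancel _ _)

  det-swapAdjacentColumns : ∀ n {M N : Matrix n} {p q} → Adjacent p q →
    (∀ i j → j ≢ p → j ≢ q → N i j ≈ M i j) → (∀ i → N i p ≈ M i q) → (∀ i → N i q ≈ M i p) →
    det R n N ≈ - det R n M
  det-swapAdjacentColumns (suc n) {M} {N} {p} {q} adj N≈M Np≈Mq Nq≈Mp = begin
    det R (suc n) N                      ≈⟨ ∑-adjacent (laplaceTerm N) (λ k → - laplaceTerm M k) adj off pair ⟩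
    ∑ (suc n) (λ k → - laplaceTerm M k)  ≈⟨ ∑-neg (suc n) (laplaceTerm M) ⟩
    - det R (suc n) M                    ∎
    where
    off : ∀ k → k ≢ p → k ≢ q → laplaceTerm N k ≈ - laplaceTerm M k
    off k k≢p k≢q = trans (*-congˡ (*-cong (N≈M zero k k≢p k≢q) minor-swapped)) (neg-inner _ _ _)
      where
      minor-swapped : det R n (minor R N k) ≈ - det R n (minor R M k)
      minor-swapped = det-swapAdjacentColumns n (punchOut-Adjacent k≢p k≢q adj)
        (λ i j j≢p′ j≢q′ → N≈M (suc i) (punchIn k j) (punchIn≢ k≢p j≢p′) (punchIn≢ k≢q j≢q′))
        (minor-punchOutColumns {L = N} {L′ = M} k≢p k≢q Np≈Mq)
        (minor-punchOutColumns {L = N} {L′ = M} k≢q k≢p Nq≈Mp)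
      neg-inner : ∀ s a d → s * (a * - d) ≈ - (s * (a * d))
      neg-inner s a d = trans (*-congˡ (sym (-‿distribʳ-* a d))) (sym (-‿distribʳ-* s (a * d)))
    agreeAt : ∀ i j → punchIn p j ≡ punchIn q j → N (suc i) (punchIn p j) ≈ M (suc i) (punchIn p j)
    agreeAt i j pj≡qj = N≈M (suc i) (punchIn p j) (punchInᵢ≢i p j) (≡.subst (_≢ q) (≡.sym pj≡qj) (punchInᵢ≢i q j))
    minor-N-p : ∀ i j → minor R N p i j ≈ minor R M q i j
    minor-N-p i j with punchIn-Adjacent adj j
    ... | inj₁ (pj≡q , qj≡p) rewrite pj≡q | qj≡p = Nq≈Mp (suc i)
    ... | inj₂ pj≡qj = trans (agreeAt i j pj≡qj) (reflexive (≡.cong (M (suc i)) pj≡qj))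
    minor-N-q : ∀ i j → minor R N q i j ≈ minor R M p i j
    minor-N-q i j with punchIn-Adjacent adj j
    ... | inj₁ (pj≡q , qj≡p) rewrite pj≡q | qj≡p = Np≈Mq (suc i)
    ... | inj₂ pj≡qj = trans (reflexive (≡.cong (N (suc i)) (≡.sym pj≡qj))) (agreeAt i j pj≡qj)
    σp≈-σq : sgn R (toℕ p) ≈ - sgn R (toℕ q)
    σp≈-σq = trans (sym (-‿involutive _)) (-‿cong (sym (sgn-Adjacent adj)))
    pair : laplaceTerm N p + laplaceTerm N q ≈ - laplaceTerm M p + - laplaceTerm M q
    pair = begin
      laplaceTerm N p + laplaceTerm N q
        ≈⟨ +-cong (*-cong σp≈-σq (*-cong (Np≈Mq zero) (det-cong n minor-N-p)))
                  (*-cong (sgn-Adjacent adj) (*-cong (Nq≈Mp zero) (det-cong n minor-N-q))) ⟩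
      - sgn R (toℕ q) * (M zero q * det R n (minor R M q)) + - sgn R (toℕ p) * (M zero p * det R n (minor R M p))
        ≈⟨ +-cong (sym (-‿distribˡ-* _ _)) (sym (-‿distribˡ-* _ _)) ⟩
      - laplaceTerm M q + - laplaceTerm M p
        ≈⟨ +-comm _ _ ⟩
      - laplaceTerm M p + - laplaceTerm M q ∎

  -- Swapping q with its left neighbour q′ brings the two equal columns one step closer.
  det-equalColumnsApart : ∀ d n {M : Matrix n} {p q} → toℕ q ≡ suc (toℕ p ℕ.+ d) → (∀ i → M i p ≈ M i q) → det R n M ≈ 0#
  det-equalColumnsApart zero n q≡ Mp≈Mq =
    det-adjacentEqualColumns n (toℕ⇒Adjacent (≡.trans q≡ (≡.cong suc (ℕ.+-identityʳ _)))) Mp≈Mq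
  det-equalColumnsApart (suc d) (suc n) {M} {p} {suc q₀} q≡ Mp≈Mq = begin
    det R (suc n) M      ≈⟨ -‿involutive _ ⟨
    - - det R (suc n) M  ≈⟨ -‿cong (det-swapAdjacentColumns (suc n) (inject₁-Adjacent q₀) swapped-off swapped-q′ swapped-q) ⟨
    - det R (suc n) M′   ≈⟨ -‿cong (det-equalColumnsApart d (suc n) {M′} q′≡ M′p≈M′q′) ⟩
    - 0#                 ≈⟨ -0#≈0# ⟩
    0#                   ∎
    where
    q′ : Fin (suc n)
    q′ = inject₁ q₀
    M′ : Matrix (suc n)
    M′ i j = M i (transpose q′ (suc q₀) j)
    q′≡ : toℕ q′ ≡ suc (toℕ p ℕ.+ d)
    q′≡ = ≡.trans (toℕ-inject₁ q₀) (ℕ.suc-injective (≡.trans q≡ (≡.cong suc (ℕ.+-suc (toℕ p) d))))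
    p≢q′ : p ≢ q′
    p≢q′ e = ℕ.m≢1+m+n (toℕ p) (≡.trans (≡.cong toℕ e) q′≡)
    p≢q : p ≢ suc q₀
    p≢q e = ℕ.m≢1+m+n (toℕ p) (≡.trans (≡.cong toℕ e) q≡)
    swapped-off : ∀ i j → j ≢ q′ → j ≢ suc q₀ → M′ i j ≈ M i j
    swapped-off i j j≢q′ j≢q = reflexive (≡.cong (M i) (transpose-other j≢q′ j≢q))
    swapped-q′ : ∀ i → M′ i q′ ≈ M i (suc q₀)
    swapped-q′ i = reflexive (≡.cong (M i) (transpose-matchˡ q′ (suc q₀)))
    swapped-q : ∀ i → M′ i (suc q₀) ≈ M i q′
    swapped-q i = reflexive (≡.cong (M i) (transpose-matchʳ q′ (suc q₀)))
    M′p≈M′q′ : ∀ i → M′ i p ≈ M′ i q′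
    M′p≈M′q′ i = trans (swapped-off i p p≢q′ p≢q) (trans (Mp≈Mq i) (sym (swapped-q′ i)))

  det-equalColumns : ∀ n {M : Matrix n} {p q} → p ≢ q → (∀ i → M i p ≈ M i q) → det R n M ≈ 0#
  det-equalColumns n {p = p} {q} p≢q Mp≈Mq with <-cmp p q
  ... | tri< p<q _ _ = det-equalColumnsApart _ n (≡.sym (ℕ.m+[n∸m]≡n p<q)) Mp≈Mq
  ... | tri≈ _ p≡q _ = contradiction p≡q p≢q
  ... | tri> _ _ q<p = det-equalColumnsApart _ n (≡.sym (ℕ.m+[n∸m]≡n q<p)) (λ i → sym (Mp≈Mq i))

  replaceColumn : ∀ {n} → Fin n → (Fin n → Carrier) → Matrix n → Matrix n
  replaceColumn q v M i j with j Fin.≟ q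
  ... | yes _ = v i
  ... | no _ = M i j

  replaceColumn-off : ∀ {n} q v (M : Matrix n) → AgreeOffColumn q (replaceColumn q v M) M
  replaceColumn-off q v M i j j≢q with j Fin.≟ q
  ... | yes j≡q = contradiction j≡q j≢q
  ... | no _ = refl

  replaceColumn-at : ∀ {n} q v (M : Matrix n) i → replaceColumn q v M i q ≈ v i
  replaceColumn-at q v M i with q Fin.≟ q
  ... | yes _ = refl
  ... | no q≢q = contradiction ≡.refl q≢q

  det-addColumnMultiple : ∀ n {M N : Matrix n} {p q} x → p ≢ q →
    AgreeOffColumn q N M → (∀ i → N i q ≈ M i q + x * M i p) → det R n N ≈ det R n M
  det-addColumnMultiple n {M} {N} {p} {q} x p≢q N≈M Nq≈ = begin
    det R n N                  ≈⟨ det-linearInColumn n q x N≈M Q≈M Nq≈′ ⟩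
    det R n M + x * det R n Q  ≈⟨ +-congˡ (*-congˡ (det-equalColumns n p≢q Qp≈Qq)) ⟩
    det R n M + x * 0#         ≈⟨ +-congˡ (zeroʳ x) ⟩
    det R n M + 0#             ≈⟨ +-identityʳ _ ⟩
    det R n M                  ∎
    where
    Q : Matrix n
    Q = replaceColumn q (λ i → M i p) M
    Q≈M : AgreeOffColumn q Q M
    Q≈M = replaceColumn-off q (λ i → M i p) M
    Qq≈Mp : ∀ i → Q i q ≈ M i p
    Qq≈Mp = replaceColumn-at q (λ i → M i p) M
    Nq≈′ : ∀ i → N i q ≈ M i q + x * Q i q
    Nq≈′ i = trans (Nq≈ i) (+-congˡ (*-congˡ (sym (Qq≈Mp i))))
    Qp≈Qq : ∀ i → Q i p ≈ Q i q
    Qp≈Qq i = trans (Q≈M i p p≢q) (sym (Qq≈Mp i))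

  private
    laplaceTerms≈0 : ∀ {n m} (M : Matrix (suc n)) (ι : Fin m → Fin (suc n)) → (∀ k → M zero (ι k) ≈ 0#) →
              ∑ m (laplaceTerm M ∘ ι) ≈ 0#
    laplaceTerms≈0 {m = m} M ι M0ι≈0 = ∑-zero m λ k → trans (*-congˡ (*-congʳ (M0ι≈0 k))) (trans (*-congˡ (zeroˡ _)) (zeroʳ _))

  det-firstRowOneEntry : ∀ n (M : Matrix (suc n)) → (∀ k → M zero (suc k) ≈ 0#) →
                         det R (suc n) M ≈ M zero zero * det R n (minor R M zero)
  det-firstRowOneEntry n M M0≈0 = trans (+-cong (*-identityˡ _) (laplaceTerms≈0 M Fin.suc M0≈0)) (+-identityʳ _)

  det-firstColumnOneEntry : ∀ n (M : Matrix (suc n)) → (∀ i → M (suc i) zero ≈ 0#) →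
                            det R (suc n) M ≈ M zero zero * det R n (minor R M zero)
  det-firstColumnOneEntry n M M0≈0 = begin
    det R (suc n) M                             ≈⟨ det-transpose (suc n) M ⟨
    det R (suc n) (M ᵀ)                         ≈⟨ det-firstRowOneEntry n (M ᵀ) M0≈0 ⟩
    M zero zero * det R n (minor R (M ᵀ) zero)  ≈⟨ *-congˡ (det-transpose n (minor R (M ᵀ) zero)) ⟨
    M zero zero * det R n (minor R M zero)      ∎

  det-firstRowTwoEntries : ∀ n (M : Matrix (suc (suc n))) → (∀ k → M zero (suc (suc k)) ≈ 0#) →
    det R (suc (suc n)) M ≈ M zero zero * det R (suc n) (minor R M zero) - M zero (suc zero) * det R (suc n) (minor R M (suc zero))
  det-firstRowTwoEntries n M M0≈0 = begin
    1# * (M zero zero * D₀) + (- 1# * (M zero (suc zero) * D₁) + rest)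
      ≈⟨ +-congˡ (+-congˡ (laplaceTerms≈0 M (Fin.suc ∘ Fin.suc) M0≈0)) ⟩
    1# * (M zero zero * D₀) + (- 1# * (M zero (suc zero) * D₁) + 0#)
      ≈⟨ simplify _ _ ⟩
    M zero zero * D₀ - M zero (suc zero) * D₁ ∎
    where
    D₀ D₁ rest : Carrier
    D₀ = det R (suc n) (minor R M zero)
    D₁ = det R (suc n) (minor R M (suc zero))
    rest = ∑ n (laplaceTerm M ∘ Fin.suc ∘ Fin.suc)
    simplify : ∀ x y → 1# * x + (- 1# * y + 0#) ≈ x - y
    simplify = solve 2 (λ x y → con (+ 1) :* x :+ (:- con (+ 1) :* y :+ con (+ 0)) := x :- y) refl

  det-addColumnMultiples₂ : ∀ n {M N : Matrix n} {p p′ q} x y → p ≢ q → p′ ≢ q →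
    AgreeOffColumn q N M → (∀ i → N i q ≈ M i q + x * M i p + y * M i p′) → det R n N ≈ det R n M
  det-addColumnMultiples₂ n {M} {N} {p} {p′} {q} x y p≢q p′≢q N≈M Nq≈ = begin
    det R n N  ≈⟨ det-addColumnMultiple n y p′≢q N≈H Nq≈Hq ⟩
    det R n H  ≈⟨ det-addColumnMultiple n x p≢q H≈M Hq≈Mq ⟩
    det R n M  ∎
    where
    H : Matrix n
    H = replaceColumn q (λ i → M i q + x * M i p) M
    H≈M : AgreeOffColumn q H M
    H≈M = replaceColumn-off q (λ i → M i q + x * M i p) M
    Hq≈Mq : ∀ i → H i q ≈ M i q + x * M i p
    Hq≈Mq = replaceColumn-at q (λ i → M i q + x * M i p) M
    N≈H : AgreeOffColumn q N H
    N≈H i j j≢q = trans (N≈M i j j≢q) (sym (H≈M i j j≢q))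
    Nq≈Hq : ∀ i → N i q ≈ H i q + y * H i p′
    Nq≈Hq i = trans (Nq≈ i) (sym (+-cong (Hq≈Mq i) (*-congˡ (H≈M i p′ p′≢q))))

  det-singleton : ∀ (M : Matrix 1) → det R 1 M ≈ M zero zero
  det-singleton M = trans (+-identityʳ _) (trans (*-identityˡ _) (*-identityʳ _))

  module Reduction (A B : Carrier) where

    residual : (ℕ → Carrier) → ℕ → Carrier
    residual v k = v (suc (suc k)) - A * v (suc k) + B * v k

    reduceColumns : (ℕ → ℕ → Carrier) → ℕ → ℕ → Carrier
    reduceColumns F j zero = F j zero
    reduceColumns F j (suc zero) = F j (suc zero)
    reduceColumns F j (suc (suc k)) = residual (F j) k

    -- Lowering r reduces one more column by adding multiples of two columns that are still unreduced,
    -- so no step changes the determinant.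
    reducedFrom : ℕ → (ℕ → ℕ → Carrier) → ℕ → ℕ → Carrier
    reducedFrom r F j k with r ≤? k
    ... | yes _ = reduceColumns F j k
    ... | no _ = F j k

    reducedFrom-≤ : ∀ r {k} F j → r ≤ k → reducedFrom r F j k ≡ reduceColumns F j k
    reducedFrom-≤ r {k} F j r≤k with r ≤? k
    ... | yes _ = ≡.refl
    ... | no r≰k = contradiction r≤k r≰k

    reducedFrom-> : ∀ r {k} F j → k < r → reducedFrom r F j k ≡ F j k
    reducedFrom-> r {k} F j k<r with r ≤? k
    ... | yes r≤k = contradiction r≤k (ℕ.<⇒≱ k<r)
    ... | no _ = ≡.refl

    reducedFrom-agree : ∀ {r k} F j → k ≢ r → reducedFrom r F j k ≡ reducedFrom (suc r) F j k
    reducedFrom-agree {r} {k} F j k≢r with ℕ.<-cmp k r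
    ... | tri< k<r _ _ = ≡.trans (reducedFrom-> r F j k<r) (≡.sym (reducedFrom-> (suc r) F j (ℕ.m<n⇒m<1+n k<r)))
    ... | tri≈ _ k≡r _ = contradiction k≡r k≢r
    ... | tri> _ _ r<k = ≡.trans (reducedFrom-≤ r F j (ℕ.<⇒≤ r<k)) (≡.sym (reducedFrom-≤ (suc r) F j r<k))

    reducedFrom-unchanged : ∀ {r} F j k → reduceColumns F j r ≡ F j r → reducedFrom r F j k ≡ reducedFrom (suc r) F j k
    reducedFrom-unchanged {r} F j k same with k ℕ.≟ r
    ... | no k≢r = reducedFrom-agree F j k≢r
    ... | yes ≡.refl = ≡.trans (reducedFrom-≤ r F j ℕ.≤-refl) (≡.trans same (≡.sym (reducedFrom-> (suc r) F j ℕ.≤-refl)))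

    det-reducedFrom-reduceColumn : ∀ n c F → suc (suc c) < n →
      det R n (mat (reducedFrom (suc (suc c)) F)) ≈ det R n (mat (reducedFrom (suc (suc (suc c))) F))
    det-reducedFrom-reduceColumn n c F r<n = det-addColumnMultiples₂ n (- A) B p≢q p′≢q off column
      where
      r = suc (suc c)
      p<n : suc c < n
      p<n = ℕ.<-trans (ℕ.n<1+n (suc c)) r<n
      p′<n : c < n
      p′<n = ℕ.<-trans (ℕ.n<1+n c) p<n
      q p p′ : Fin n
      q = fromℕ< r<n
      p = fromℕ< p<n
      p′ = fromℕ< p′<n
      p≢q : p ≢ q
      p≢q = fromℕ<-≢ p<n r<n (ℕ.<⇒≢ (ℕ.n<1+n _))
      p′≢q : p′ ≢ q
      p′≢q = fromℕ<-≢ p′<n r<n (ℕ.<⇒≢ (ℕ.<-trans (ℕ.n<1+n _) (ℕ.n<1+n _)))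
      N M : Matrix n
      N = mat (reducedFrom r F)
      M = mat (reducedFrom (suc r) F)
      off : AgreeOffColumn q N M
      off i j j≢q = reflexive (reducedFrom-agree F (toℕ i) (λ e → j≢q (toℕ-injective (≡.trans e (≡.sym (toℕ-fromℕ< r<n))))))
      unreduced : ∀ i (k : Fin n) {m} → toℕ k ≡ m → m ≤ r → M i k ≈ F (toℕ i) m
      unreduced i k ≡.refl m≤r = reflexive (reducedFrom-> (suc r) F (toℕ i) (s≤s m≤r))
      column : ∀ i → N i q ≈ M i q + - A * M i p + B * M i p′
      column i = begin
        N i q
          ≈⟨ reflexive (≡.trans (≡.cong (reducedFrom r F (toℕ i)) (toℕ-fromℕ< r<n)) (reducedFrom-≤ r F (toℕ i) ℕ.≤-refl)) ⟩
        F (toℕ i) r - A * F (toℕ i) (suc c) + B * F (toℕ i) c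
          ≈⟨ +-congʳ (+-congˡ (-‿distribˡ-* A (F (toℕ i) (suc c)))) ⟩
        F (toℕ i) r + - A * F (toℕ i) (suc c) + B * F (toℕ i) c
          ≈⟨ +-cong (+-cong (unreduced i q (toℕ-fromℕ< r<n) ℕ.≤-refl) (*-congˡ (unreduced i p (toℕ-fromℕ< p<n) (ℕ.n≤1+n _))))
                    (*-congˡ (unreduced i p′ (toℕ-fromℕ< p′<n) (ℕ.≤-trans (ℕ.n≤1+n _) (ℕ.n≤1+n _)))) ⟨
        M i q + - A * M i p + B * M i p′ ∎

    det-reducedFrom-suc : ∀ n r F → det R n (mat (reducedFrom r F)) ≈ det R n (mat (reducedFrom (suc r) F))
    det-reducedFrom-suc n zero F = det-cong n λ i j → reflexive (reducedFrom-unchanged F (toℕ i) (toℕ j) ≡.refl)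
    det-reducedFrom-suc n (suc zero) F = det-cong n λ i j → reflexive (reducedFrom-unchanged F (toℕ i) (toℕ j) ≡.refl)
    det-reducedFrom-suc n (suc (suc c)) F with suc (suc c) <? n
    ... | yes r<n = det-reducedFrom-reduceColumn n c F r<n
    ... | no r≮n = det-cong n λ i j → reflexive (reducedFrom-agree F (toℕ i) (λ e → r≮n (≡.subst (_< n) e (toℕ<n j))))

    det-reduceColumns : ∀ n F → det R n (mat (reduceColumns F)) ≈ det R n (mat F)
    det-reduceColumns n F = begin
      det R n (mat (reduceColumns F))   ≈⟨ det-cong n (λ i j → reflexive (≡.sym (reducedFrom-≤ 0 {toℕ j} F (toℕ i) z≤n))) ⟩
      det R n (mat (reducedFrom 0 F))   ≈⟨ steps n ⟩
      det R n (mat (reducedFrom n F))   ≈⟨ det-cong n (λ i j → reflexive (reducedFrom-> n F (toℕ i) (toℕ<n j))) ⟩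
      det R n (mat F)                   ∎
      where
      steps : ∀ r → det R n (mat (reducedFrom 0 F)) ≈ det R n (mat (reducedFrom r F))
      steps zero = refl
      steps (suc r) = trans (steps r) (det-reducedFrom-suc n r F)

  shift : (ℕ → Carrier) → ℕ → Carrier
  shift d k = d (suc k)

  -- The (suc j) (suc k) clause precedes the boundary clauses so that it applies without inspecting j.
  tridiagonal : (ℕ → Carrier) → (ℕ → Carrier) → ℕ → ℕ → Carrier
  tridiagonal d e zero zero = d 0
  tridiagonal d e zero (suc zero) = e 0
  tridiagonal d e zero (suc (suc k)) = 0#
  tridiagonal d e (suc j) (suc k) = tridiagonal (shift d) (shift e) j k
  tridiagonal d e (suc zero) zero = e 0
  tridiagonal d e (suc (suc j)) zero = 0#

  det-tridiagonal : ∀ n d e →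
    det R (suc (suc n)) (mat (tridiagonal d e))
      ≈ d 0 * det R (suc n) (mat (tridiagonal (shift d) (shift e)))
        - e 0 * (e 0 * det R n (mat (tridiagonal (shift (shift d)) (shift (shift e)))))
  det-tridiagonal n d e = begin
    det R (suc (suc n)) M
      ≈⟨ det-firstRowTwoEntries n M (λ _ → refl) ⟩
    d 0 * det R (suc n) (mat (tridiagonal (shift d) (shift e))) - e 0 * det R (suc n) (minor R M (suc zero))
      ≈⟨ +-congˡ (-‿cong (*-congˡ (det-firstColumnOneEntry n (minor R M (suc zero)) (λ _ → refl)))) ⟩
    d 0 * det R (suc n) (mat (tridiagonal (shift d) (shift e)))
      - e 0 * (e 0 * det R n (mat (tridiagonal (shift (shift d)) (shift (shift e))))) ∎
    where
    M : Matrix (suc (suc n))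
    M = mat (tridiagonal d e)

  det-constantTridiagonal : ∀ n {a b c} → b * b ≈ c → det R n (mat (tridiagonal (λ _ → a) (λ _ → b))) ≈ lucas R a c (suc n)
  det-constantTridiagonal zero b²≈c = refl
  det-constantTridiagonal (suc zero) {a} {b} {c} b²≈c =
    trans (det-singleton (mat (tridiagonal (λ _ → a) (λ _ → b)))) (solve 2 (λ a c → a := a :* con (+ 1) :- c :* con (+ 0)) refl a c)
  det-constantTridiagonal (suc (suc n)) {a} {b} {c} b²≈c = begin
    det R (suc (suc n)) (mat (tridiagonal (λ _ → a) (λ _ → b)))
      ≈⟨ det-tridiagonal n (λ _ → a) (λ _ → b) ⟩
    a * det R (suc n) (mat (tridiagonal (λ _ → a) (λ _ → b))) - b * (b * det R n (mat (tridiagonal (λ _ → a) (λ _ → b))))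
      ≈⟨ +-cong (*-congˡ (det-constantTridiagonal (suc n) b²≈c)) (-‿cong (*-congˡ (*-congˡ (det-constantTridiagonal n b²≈c)))) ⟩
    a * lucas R a c (suc (suc n)) - b * (b * lucas R a c (suc n))
      ≈⟨ +-congˡ (-‿cong (trans (*-congʳ (sym b²≈c)) (*-assoc b b _))) ⟨
    lucas R a c (suc (suc (suc n))) ∎

  module Theorem (A B : Carrier) (w : ℕ → Carrier) (rec : ∀ n → w (suc (suc n)) ≈ A * w (suc n) - B * w n) where
    open Reduction A B

    A′ t B′ s C : Carrier
    A′ = (A * A - B * B + 1#) * w 0 - (1# + 1#) * A * w 1
    t = A * w 0 - (B + 1#) * w 1
    B′ = t * t
    s = A * w 0 - w 1
    C = (B * w 0) * (B * w 0) - s * s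

    residual≈0 : ∀ k → residual w k ≈ 0#
    residual≈0 k = trans (+-congʳ (+-congʳ (rec k))) (cancel A B (w (suc k)) (w k))
      where
      cancel : ∀ a b x y → a * x - b * y - a * x + b * y ≈ 0#
      cancel = solve 4 (λ a b x y → a :* x :- b :* y :- a :* x :+ b :* y := con (+ 0)) refl

    toeplitz : ℕ → ℕ → Carrier
    toeplitz j k = w ∣ j - k ∣

    -- Uᵀ T U, with flip transposing T U.
    reduced : ℕ → ℕ → Carrier
    reduced = reduceColumns (flip (reduceColumns toeplitz))

    diagonal offDiagonal : ℕ → Carrier
    diagonal zero = w 0
    diagonal (suc zero) = w 0
    diagonal (suc (suc k)) = A′
    offDiagonal zero = w 1
    offDiagonal (suc k) = - t

    residual≈0′ : ∀ k → w (suc (suc k)) - A * w (suc k) + B * w ∣ k - 0 ∣ ≈ 0#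
    residual≈0′ k rewrite ℕ.∣-∣-identityʳ k = residual≈0 k

    combination≈0 : ∀ {x y z} → x ≈ 0# → y ≈ 0# → z ≈ 0# → x - A * y + B * z ≈ 0#
    combination≈0 {x} {y} {z} x≈0 y≈0 z≈0 = begin
      x - A * y + B * z      ≈⟨ +-cong (+-cong x≈0 (-‿cong (*-congˡ y≈0))) (*-congˡ z≈0) ⟩
      0# - A * 0# + B * 0#   ≈⟨ solve 2 (λ a b → con (+ 0) :- a :* con (+ 0) :+ b :* con (+ 0) := con (+ 0)) refl A B ⟩
      0#                     ∎

    dropVanishing : ∀ {x y z} → x ≈ y + z → z ≈ 0# → x ≈ y
    dropVanishing {y = y} x≈y+z z≈0 = trans x≈y+z (trans (+-congˡ z≈0) (+-identityʳ y))

    boundaryResidual : w 1 - A * w 0 + B * w 1 ≈ - t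
    boundaryResidual =
      solve 4 (λ a b x₀ x₁ → x₁ :- a :* x₀ :+ b :* x₁ := :- (a :* x₀ :- (b :+ con (+ 1)) :* x₁)) refl A B (w 0) (w 1)

    reduced≈tridiagonal : ∀ j k → reduced j k ≈ tridiagonal diagonal offDiagonal j k
    reduced≈tridiagonal zero zero = refl
    reduced≈tridiagonal zero (suc zero) = refl
    reduced≈tridiagonal zero (suc (suc k)) = residual≈0′ k
    reduced≈tridiagonal (suc zero) zero = refl
    reduced≈tridiagonal (suc zero) (suc zero) = refl
    reduced≈tridiagonal (suc zero) (suc (suc zero)) = boundaryResidual
    reduced≈tridiagonal (suc zero) (suc (suc (suc k))) = residual≈0′ k
    reduced≈tridiagonal (suc (suc j)) zero = residual≈0 j
    reduced≈tridiagonal (suc (suc zero)) (suc zero) = boundaryResidual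
    reduced≈tridiagonal (suc (suc (suc j))) (suc zero) = residual≈0 j
    reduced≈tridiagonal (suc (suc zero)) (suc (suc zero)) =
      dropVanishing (entry₂₂ A B (w 0) (w 1) (w 2)) (trans (*-congˡ (residual≈0 0)) (zeroʳ _))
      where
      entry₂₂ : ∀ a b x₀ x₁ x₂ →
        (x₀ - a * x₁ + b * x₂) - a * (x₁ - a * x₀ + b * x₁) + b * (x₂ - a * x₁ + b * x₀)
          ≈ ((a * a - b * b + 1#) * x₀ - (1# + 1#) * a * x₁) + (b + b) * (x₂ - a * x₁ + b * x₀)
      entry₂₂ = solve 5 (λ a b x₀ x₁ x₂ →
        (x₀ :- a :* x₁ :+ b :* x₂) :- a :* (x₁ :- a :* x₀ :+ b :* x₁) :+ b :* (x₂ :- a :* x₁ :+ b :* x₀)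
          := ((a :* a :- b :* b :+ con (+ 1)) :* x₀ :- (con (+ 1) :+ con (+ 1)) :* a :* x₁) :+ (b :+ b) :* (x₂ :- a :* x₁ :+ b :* x₀)) refl
    reduced≈tridiagonal (suc (suc zero)) (suc (suc (suc zero))) =
      dropVanishing (entry₂₃ A B (w 0) (w 1) (w 2) (w 3)) (combination≈0 refl (residual≈0 0) (residual≈0 1))
      where
      entry₂₃ : ∀ a b x₀ x₁ x₂ x₃ →
        (x₁ - a * x₂ + b * x₃) - a * (x₀ - a * x₁ + b * x₂) + b * (x₁ - a * x₀ + b * x₁)
          ≈ - (a * x₀ - (b + 1#) * x₁) + (0# - a * (x₂ - a * x₁ + b * x₀) + b * (x₃ - a * x₂ + b * x₁))
      entry₂₃ = solve 6 (λ a b x₀ x₁ x₂ x₃ →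
        (x₁ :- a :* x₂ :+ b :* x₃) :- a :* (x₀ :- a :* x₁ :+ b :* x₂) :+ b :* (x₁ :- a :* x₀ :+ b :* x₁)
          := :- (a :* x₀ :- (b :+ con (+ 1)) :* x₁)
             :+ (con (+ 0) :- a :* (x₂ :- a :* x₁ :+ b :* x₀) :+ b :* (x₃ :- a :* x₂ :+ b :* x₁))) refl
    reduced≈tridiagonal (suc (suc (suc zero))) (suc (suc zero)) =
      dropVanishing (entry₃₂ A B (w 0) (w 1) (w 2) (w 3)) (combination≈0 refl (residual≈0 0) (residual≈0 1))
      where
      entry₃₂ : ∀ a b x₀ x₁ x₂ x₃ →
        (x₁ - a * x₀ + b * x₁) - a * (x₂ - a * x₁ + b * x₀) + b * (x₃ - a * x₂ + b * x₁)
          ≈ - (a * x₀ - (b + 1#) * x₁) + (0# - a * (x₂ - a * x₁ + b * x₀) + b * (x₃ - a * x₂ + b * x₁))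
      entry₃₂ = solve 6 (λ a b x₀ x₁ x₂ x₃ →
        (x₁ :- a :* x₀ :+ b :* x₁) :- a :* (x₂ :- a :* x₁ :+ b :* x₀) :+ b :* (x₃ :- a :* x₂ :+ b :* x₁)
          := :- (a :* x₀ :- (b :+ con (+ 1)) :* x₁)
             :+ (con (+ 0) :- a :* (x₂ :- a :* x₁ :+ b :* x₀) :+ b :* (x₃ :- a :* x₂ :+ b :* x₁))) refl
    reduced≈tridiagonal (suc (suc zero)) (suc (suc (suc (suc k)))) rewrite ℕ.∣-∣-identityʳ k =
      trans (resum A B (w k) (w (suc k)) (w (suc (suc k))) (w (suc (suc (suc k)))) (w (suc (suc (suc (suc k))))))
            (combination≈0 (residual≈0 k) (residual≈0 (suc k)) (residual≈0 (suc (suc k))))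
      where
      -- Reducing rows after columns equals reducing columns after rows.
      resum : ∀ a b x₀ x₁ x₂ x₃ x₄ →
        (x₂ - a * x₃ + b * x₄) - a * (x₁ - a * x₂ + b * x₃) + b * (x₀ - a * x₁ + b * x₂)
          ≈ (x₂ - a * x₁ + b * x₀) - a * (x₃ - a * x₂ + b * x₁) + b * (x₄ - a * x₃ + b * x₂)
      resum = solve 7 (λ a b x₀ x₁ x₂ x₃ x₄ →
        (x₂ :- a :* x₃ :+ b :* x₄) :- a :* (x₁ :- a :* x₂ :+ b :* x₃) :+ b :* (x₀ :- a :* x₁ :+ b :* x₂)
          := (x₂ :- a :* x₁ :+ b :* x₀) :- a :* (x₃ :- a :* x₂ :+ b :* x₁) :+ b :* (x₄ :- a :* x₃ :+ b :* x₂)) refl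
    reduced≈tridiagonal (suc (suc (suc (suc j)))) (suc (suc zero)) =
      combination≈0 (residual≈0 j) (residual≈0 (suc j)) (residual≈0 (suc (suc j)))
    -- Both matrices are invariant under shifting j and k by one beyond the second row and column;
    -- for the Toeplitz matrix this holds definitionally since ∣ suc j - suc k ∣ = ∣ j - k ∣.
    reduced≈tridiagonal (suc (suc (suc j))) (suc (suc (suc k))) = reduced≈tridiagonal (suc (suc j)) (suc (suc k))

    u : ℕ → Carrier
    u = lucas R A′ B′

    det-lucasBlock : ∀ m → det R m (mat (tridiagonal (λ _ → A′) (λ _ → - t))) ≈ u (suc m)
    det-lucasBlock m = det-constantTridiagonal m (solve 1 (λ t → (:- t) :* (:- t) := t :* t) refl t)

    det-shiftedTridiagonal : ∀ m → det R (suc m) (mat (tridiagonal (shift diagonal) (shift offDiagonal))) ≈ w 0 * u (suc m) - B′ * u m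
    det-shiftedTridiagonal zero =
      trans (det-singleton (mat (tridiagonal (shift diagonal) (shift offDiagonal))))
            (solve 2 (λ x b → x := x :* con (+ 1) :- b :* con (+ 0)) refl (w 0) B′)
    det-shiftedTridiagonal (suc m) = begin
      det R (suc (suc m)) (mat (tridiagonal (shift diagonal) (shift offDiagonal)))
        ≈⟨ det-tridiagonal m (shift diagonal) (shift offDiagonal) ⟩
      w 0 * det R (suc m) (mat (tridiagonal (λ _ → A′) (λ _ → - t)))
        - - t * (- t * det R m (mat (tridiagonal (λ _ → A′) (λ _ → - t))))
        ≈⟨ +-cong (*-congˡ (det-lucasBlock (suc m))) (-‿cong (*-congˡ (*-congˡ (det-lucasBlock m)))) ⟩
      w 0 * u (suc (suc m)) - - t * (- t * u (suc m))
        ≈⟨ +-congˡ (-‿cong (solve 2 (λ t x → (:- t) :* ((:- t) :* x) := (t :* t) :* x) refl t (u (suc m)))) ⟩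
      w 0 * u (suc (suc m)) - B′ * u (suc m) ∎

    cornerIdentity : w 0 * w 0 - w 1 * w 1 ≈ w 0 * A′ + C
    cornerIdentity = solve 4 (λ a b x₀ x₁ →
      x₀ :* x₀ :- x₁ :* x₁
        := x₀ :* ((a :* a :- b :* b :+ con (+ 1)) :* x₀ :- (con (+ 1) :+ con (+ 1)) :* a :* x₁)
           :+ ((b :* x₀) :* (b :* x₀) :- (a :* x₀ :- x₁) :* (a :* x₀ :- x₁))) refl A B (w 0) (w 1)

    det-tridiagonalMatrix : ∀ m → det R (suc m) (mat (tridiagonal diagonal offDiagonal)) ≈ w 0 * u (suc m) + C * u m
    det-tridiagonalMatrix zero =
      trans (det-singleton (mat (tridiagonal diagonal offDiagonal)))
            (solve 2 (λ x c → x := x :* con (+ 1) :+ c :* con (+ 0)) refl (w 0) C)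
    det-tridiagonalMatrix (suc m) = begin
      det R (suc (suc m)) (mat (tridiagonal diagonal offDiagonal))
        ≈⟨ det-tridiagonal m diagonal offDiagonal ⟩
      w 0 * det R (suc m) (mat (tridiagonal (shift diagonal) (shift offDiagonal)))
        - w 1 * (w 1 * det R m (mat (tridiagonal (λ _ → A′) (λ _ → - t))))
        ≈⟨ +-cong (*-congˡ (det-shiftedTridiagonal m)) (-‿cong (*-congˡ (*-congˡ (det-lucasBlock m)))) ⟩
      w 0 * (w 0 * u (suc m) - B′ * u m) - w 1 * (w 1 * u (suc m))
        ≈⟨ regroup (w 0) (w 1) B′ (u (suc m)) (u m) ⟩
      (w 0 * w 0 - w 1 * w 1) * u (suc m) - w 0 * (B′ * u m)
        ≈⟨ +-congʳ (*-congʳ cornerIdentity) ⟩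
      (w 0 * A′ + C) * u (suc m) - w 0 * (B′ * u m)
        ≈⟨ ungroup (w 0) A′ B′ C (u (suc m)) (u m) ⟩
      w 0 * u (suc (suc m)) + C * u (suc m) ∎
      where
      regroup : ∀ x₀ x₁ b X Y → x₀ * (x₀ * X - b * Y) - x₁ * (x₁ * X) ≈ (x₀ * x₀ - x₁ * x₁) * X - x₀ * (b * Y)
      regroup = solve 5 (λ x₀ x₁ b X Y →
        x₀ :* (x₀ :* X :- b :* Y) :- x₁ :* (x₁ :* X) := (x₀ :* x₀ :- x₁ :* x₁) :* X :- x₀ :* (b :* Y)) refl
      ungroup : ∀ x₀ a b c X Y → (x₀ * a + c) * X - x₀ * (b * Y) ≈ x₀ * (a * X - b * Y) + c * X
      ungroup = solve 6 (λ x₀ a b c X Y →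
        (x₀ :* a :+ c) :* X :- x₀ :* (b :* Y) := x₀ :* (a :* X :- b :* Y) :+ c :* X) refl

    det-toeplitz : ∀ m → det R (suc m) (mat toeplitz) ≈ w 0 * u (suc m) + C * u m
    det-toeplitz m = begin
      det R (suc m) (mat toeplitz)                            ≈⟨ det-reduceColumns (suc m) toeplitz ⟨
      det R (suc m) (mat (reduceColumns toeplitz))            ≈⟨ det-transpose (suc m) (mat (reduceColumns toeplitz)) ⟨
      det R (suc m) (mat (flip (reduceColumns toeplitz)))     ≈⟨ det-reduceColumns (suc m) (flip (reduceColumns toeplitz)) ⟨
      det R (suc m) (mat reduced)                             ≈⟨ det-cong (suc m) (λ i j → reduced≈tridiagonal (toℕ i) (toℕ j)) ⟩
      det R (suc m) (mat (tridiagonal diagonal offDiagonal))  ≈⟨ det-tridiagonalMatrix m ⟩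
      w 0 * u (suc m) + C * u m                               ∎

theorem1p1 : ∀ {c ℓ} (R : CommutativeRing c ℓ) →
  let open CommutativeRing R in
  (A B : Carrier) (w : ℕ → Carrier) →
  (∀ n → w (suc (suc n)) ≈ A * w (suc n) - B * w n) →
  let A′ = (A * A - B * B + 1#) * w 0 - (1# + 1#) * A * w 1
      t = A * w 0 - (B + 1#) * w 1
      B′ = t * t
      s = A * w 0 - w 1
  in
  (n : ℕ) → 1 ≤ n →
  det R n (λ j k → w ∣ toℕ j - toℕ k ∣)
    ≈ w 0 * lucas R A′ B′ n + ((B * w 0) * (B * w 0) - s * s) * lucas R A′ B′ (n ∸ 1)
theorem1p1 R A B w rec (suc m) _ = Theorem.det-toeplitz R A B w rec m
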